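{- The quasi-orders $\preccurlyeq_2^s$ and $\preccurlyeq_2^p$ on $\mathcal P(M_2)$ are Borel bireducible: $\preccurlyeq_2^s\leq_B\preccurlyeq_2^p$ and $\preccurlyeq_2^p\leq_B\preccurlyeq_2^s$.
   Context: $M_2$ is the free monoid on generators $a,b$, and $\mathcal P(M_2)$ is identified with $2^{M_2}$. For $A,B\subseteq M_2$: $A\preccurlyeq_2^s B$ iff there is $m\in M_2$ with $Am=B\cap M_2m$; and $A\preccurlyeq_2^p B$ iff there is $m\in M_2$ with $mA=B\cap mM_2$. $Q\leq_B Q'$ means there is a Borel map $f$ with $x\mathbin{Q}y\Leftrightarrow f(x)\mathbin{Q'}f(y)$. -}

module Defs where

open import Data.Bool using (Bool; true; false)
open import Data.List using (List; _++_)
open import Data.Nat using (ℕ)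
open import Data.Product using (Σ; ∃; _×_; _,_)
open import Relation.Binary.PropositionalEquality using (_≡_)
open import Relation.Nullary using (¬_)
open import Function.Bundles using (_⇔_)

-- The free monoid M₂ on generators a, b: words over a two-letter alphabet
-- (false = a, true = b), multiplication is concatenation.
M₂ : Set
M₂ = List Bool

-- 𝒫(M₂) identified with the Cantor space 2^{M₂}.
𝒫M₂ : Set
𝒫M₂ = M₂ → Bool

_∈_ : M₂ → 𝒫M₂ → Set
w ∈ A = A w ≡ true

_∈_·ʳ_ : M₂ → 𝒫M₂ → M₂ → Set
w ∈ A ·ʳ m = Σ M₂ λ u → (u ∈ A) × (w ≡ u ++ m)

_∈_·ˡ_ : M₂ → M₂ → 𝒫M₂ → Set
w ∈ m ·ˡ A = Σ M₂ λ u → (u ∈ A) × (w ≡ m ++ u)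

_≼s_ : 𝒫M₂ → 𝒫M₂ → Set
A ≼s B = Σ M₂ λ m → (w : M₂) →
  (w ∈ A ·ʳ m) ⇔ ((w ∈ B) × (Σ M₂ λ u → w ≡ u ++ m))

_≼p_ : 𝒫M₂ → 𝒫M₂ → Set
A ≼p B = Σ M₂ λ m → (w : M₂) →
  (w ∈ m ·ˡ A) ⇔ ((w ∈ B) × (Σ M₂ λ u → w ≡ m ++ u))

-- Borel sets of the Cantor space 2^{M₂}: the σ-algebra generated by the
-- subbasic clopen sets { x : x w = true }, presented by Borel codes.

data BorelCode : Set where
  basic : M₂ → BorelCode
  compl : BorelCode → BorelCode
  ⋃     : (ℕ → BorelCode) → BorelCode

⟦_⟧ : BorelCode → 𝒫M₂ → Set
⟦ basic w ⟧ x = w ∈ x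
⟦ compl c ⟧ x = ¬ ⟦ c ⟧ x
⟦ ⋃ cs ⟧ x = ∃ λ n → ⟦ cs n ⟧ x

IsBorelSet : (𝒫M₂ → Set) → Set
IsBorelSet S = Σ BorelCode λ c → (x : 𝒫M₂) → S x ⇔ ⟦ c ⟧ x

-- f : 2^{M₂} → 2^{M₂} is Borel iff preimages of the subbasic (clopen)
-- sets { y : y w = true } are Borel (these generate the Borel σ-algebra).
IsBorelMap : (𝒫M₂ → 𝒫M₂) → Set
IsBorelMap f = (w : M₂) → IsBorelSet (λ x → w ∈ f x)

_≤B_ : (𝒫M₂ → 𝒫M₂ → Set) → (𝒫M₂ → 𝒫M₂ → Set) → Set
Q ≤B Q' = Σ (𝒫M₂ → 𝒫M₂) λ f → IsBorelMap f ×
  ((x y : 𝒫M₂) → Q x y ⇔ Q' (f x) (f y))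

-- Reversing words is an involutive anti-automorphism of M₂: it sends right
-- translates A m to left translates m̃ Ã and M₂ m to m̃ M₂.  So A ↦ Ã, the
-- image of A under reversal, is a continuous reduction of ≼₂ˢ to ≼₂ᵖ and,
-- symmetrically, of ≼₂ᵖ to ≼₂ˢ; it reflects the relations because it is an
-- involution.

module Submission where

open import Defs
open import Data.List using (_++_; reverse)
open import Data.List.Properties using (reverse-involutive; reverse-++)
open import Data.Product using (Σ; _×_; _,_)
open import Function.Base using (_∘_; flip; id)
open import Function.Bundles using (_⇔_; mk⇔; Equivalence)
open import Relation.Binary.PropositionalEquality
  using (_≡_; _≗_; refl; sym; trans; cong; cong₂; module ≡-Reasoning)
open import Algebra.Definitions {A = M₂} _≡_ using (Involutive)

open Equivalence using (to; from)

-- A ≼s B is A ≼[ _++_ ] B and A ≼p B is A ≼[ flip _++_ ] B, definitionally.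
_≼[_]_ : 𝒫M₂ → (M₂ → M₂ → M₂) → 𝒫M₂ → Set
A ≼[ _·_ ] B = Σ M₂ λ m → (w : M₂) →
  (Σ M₂ λ u → (u ∈ A) × (w ≡ u · m)) ⇔ ((w ∈ B) × (Σ M₂ λ u → w ≡ u · m))

∈-resp-≗ : {A A′ : 𝒫M₂} → A ≗ A′ → {w : M₂} → w ∈ A → w ∈ A′
∈-resp-≗ A≗A′ {w} w∈A = trans (sym (A≗A′ w)) w∈A

≼-resp-≗ : ∀ {_·_ A A′ B B′} → A ≗ A′ → B ≗ B′ → A ≼[ _·_ ] B → A′ ≼[ _·_ ] B′
≼-resp-≗ A≗A′ B≗B′ (m , A·m≡B∩M·m) = m , λ w → mk⇔
  (λ (u , u∈A′ , w≡u·m) →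
     let (w∈B , w∈M·m) = to (A·m≡B∩M·m w) (u , ∈-resp-≗ (sym ∘ A≗A′) u∈A′ , w≡u·m)
     in ∈-resp-≗ B≗B′ w∈B , w∈M·m)
  (λ (w∈B′ , w∈M·m) →
     let (u , u∈A , w≡u·m) = from (A·m≡B∩M·m w) (∈-resp-≗ (sym ∘ B≗B′) w∈B′ , w∈M·m)
     in u , ∈-resp-≗ A≗A′ u∈A , w≡u·m)

module AntiAutomorphism
  (r : M₂ → M₂) (r-involutive : Involutive r)
  {_·_ _⋆_ : M₂ → M₂ → M₂} (r-antihom : ∀ u v → r (u · v) ≡ r u ⋆ r v)
  where

  open ≡-Reasoning

  r-shift : ∀ {w u v} → r w ≡ u · v → w ≡ r u ⋆ r v
  r-shift {w} {u} {v} rw≡u·v = begin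
    w             ≡⟨ sym (r-involutive w) ⟩
    r (r w)       ≡⟨ cong r rw≡u·v ⟩
    r (u · v)     ≡⟨ r-antihom u v ⟩
    r u ⋆ r v     ∎

  r-antihom⁻ : ∀ u v → r (u ⋆ v) ≡ r u · r v
  r-antihom⁻ u v = begin
    r (u ⋆ v)               ≡⟨ cong r (cong₂ _⋆_ (r-involutive u) (r-involutive v)) ⟨
    r (r (r u) ⋆ r (r v))   ≡⟨ cong r (r-antihom (r u) (r v)) ⟨
    r (r (r u · r v))       ≡⟨ r-involutive (r u · r v) ⟩
    r u · r v               ∎

  ≼-image : ∀ {A B} → A ≼[ _·_ ] B → (A ∘ r) ≼[ _⋆_ ] (B ∘ r)
  ≼-image {A} (m , A·m≡B∩M·m) = r m , λ w → mk⇔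
    (λ (u , ru∈A , w≡u⋆rm) →
       let (rw∈B , u′ , rw≡u′·m) =
             to (A·m≡B∩M·m (r w)) (r u , ru∈A , r-image w≡u⋆rm)
       in rw∈B , r u′ , r-shift rw≡u′·m)
    (λ (rw∈B , u , w≡u⋆rm) →
       let (u′ , u′∈A , rw≡u′·m) =
             from (A·m≡B∩M·m (r w)) (rw∈B , r u , r-image w≡u⋆rm)
       in r u′ , ∈-resp-≗ (cong A ∘ sym ∘ r-involutive) u′∈A , r-shift rw≡u′·m)
    where
    r-image : ∀ {w u} → w ≡ u ⋆ r m → r w ≡ r u · m
    r-image {u = u} refl = trans (r-antihom⁻ u (r m)) (cong (r u ·_) (r-involutive m))

≼⇔≼-image : (r : M₂ → M₂) → Involutive r →
            ∀ {_·_ _⋆_} → (∀ u v → r (u · v) ≡ r u ⋆ r v) →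
            ∀ {A B} → A ≼[ _·_ ] B ⇔ (A ∘ r) ≼[ _⋆_ ] (B ∘ r)
≼⇔≼-image r r-involutive r-antihom {A = A} {B} = mk⇔ (≼-image r-antihom)
  (≼-resp-≗ (cong A ∘ r-involutive) (cong B ∘ r-involutive)
   ∘ ≼-image (AntiAutomorphism.r-antihom⁻ r r-involutive r-antihom))
  where open AntiAutomorphism r r-involutive using (≼-image)

∘-isBorelMap : (r : M₂ → M₂) → IsBorelMap (_∘ r)
∘-isBorelMap r w = basic (r w) , λ _ → mk⇔ id id

≼-≤B : (r : M₂ → M₂) → Involutive r →
       (_·_ _⋆_ : M₂ → M₂ → M₂) → (∀ u v → r (u · v) ≡ r u ⋆ r v) →
       (λ A B → A ≼[ _·_ ] B) ≤B (λ A B → A ≼[ _⋆_ ] B)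
≼-≤B r r-involutive _ _ r-antihom =
  (_∘ r) , ∘-isBorelMap r , λ _ _ → ≼⇔≼-image r r-involutive r-antihom

theorem3p4 : (_≼s_ ≤B _≼p_) × (_≼p_ ≤B _≼s_)
theorem3p4 =
  ≼-≤B reverse reverse-involutive _++_ (flip _++_) reverse-++ ,
  ≼-≤B reverse reverse-involutive (flip _++_) _++_ (flip reverse-++)
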